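{- Let $\mathcal{S}$ be a realizability structure and $t$ a term. Then $t$ realizes $\mathrm{Bool}(0)$ with respect to $\mathcal{S}$ if and only if for all terms $u,v$ and all stacks $\pi$, $\{t\star u\cdot v\cdot\pi\}\succ_{\mathcal{S}}\{u\star\pi\}$; and $t$ realizes $\mathrm{Bool}(1)$ with respect to $\mathcal{S}$ if and only if for all terms $u,v$ and all stacks $\pi$, $\{t\star u\cdot v\cdot\pi\}\succ_{\mathcal{S}}\{v\star\pi\}$.
   Context: $\lambda_c$-calculus. Fix a countably infinite set of variables. $\lambda_c$-terms: $t,u ::= x \mid tu \mid \lambda x.t \mid \mathrm{cc} \mid k_\pi$ ($\pi$ a stack) $\mid \kappa_m$ ($m\in\mathbb{N}$) $\mid \beta_m$ ($m\in\mathbb{N}$), modulo $\alpha$-equivalence. A term is a closed $\lambda_c$-term; $\Lambda$ the set of terms. Stacks: $\pi ::= \omega_m \mid t\cdot\pi$; $\Pi$ the set of stacks. Processes: $t\star\pi$. One-step evaluation $\succ_1$: $tu\star\pi \succ_1 t\star u\cdot\pi$, $\lambda x.t\star u\cdot\pi\succ_1 t[x:=u]\star\pi$, $\mathrm{cc}\star t\cdot\pi\succ_1 t\star k_\pi\cdot\pi$, $k_{\pi'}\star t\cdot\pi\succ_1 t\star\pi'$; $\succ$ its reflexive-transitive closure. A pole is a set $\perp\!\!\!\perp$ of processes with $p\succ q$, $q\in\perp\!\!\!\perp\Rightarrow p\in\perp\!\!\!\perp$. A realizability structure is a set $\mathcal{S}$ of poles. For a pole: if $X$ is a unary second-order variable,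 $\|\forall X\,A\|=\bigcup_{F:\mathbb{N}\to\mathcal{P}(\Pi)}\|A[X:=F]\|$ with $\|F(k)\|=F(k)$; $\|A\to B\|=\{t\cdot\pi:t\in|A|,\pi\in\|B\|\}$; $|A|=\{t\in\Lambda:\forall\pi\in\|A\|,\ t\star\pi\in\perp\!\!\!\perp\}$. A term realizes $A$ w.r.t. $\mathcal{S}$ if it lies in $|A|$ for every pole of $\mathcal{S}$. $\mathrm{Bool}(y)$ is the formula $\forall X\,(X(0)\to X(1)\to X(y))$. $\succ_{\mathcal{S}}$ is the relation on sets of processes: $P\succ_{\mathcal{S}}Q$ iff for all $\perp\!\!\!\perp\in\mathcal{S}$, $Q\subseteq\perp\!\!\!\perp$ implies $P\cap\perp\!\!\!\perp\neq\emptyset$. -}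

module Defs where

open import Data.Nat using (ℕ; zero; suc)
open import Data.Fin using (Fin; zero; suc)
open import Data.Product using (Σ; ∃; _×_; _,_)
open import Data.Empty using (⊥)
open import Data.Unit using (⊤)
import Level
open import Level using (Lift)
open import Relation.Binary.PropositionalEquality using (_≡_)
open import Relation.Binary.Construct.Closure.ReflexiveTransitive using (Star)

-- λc-terms, with de Bruijn indices (so α-equivalence is syntactic
-- equality).  Term n = λc-terms with at most n free variables;
-- a "term" in the paper's sense is a closed one, Term 0.

data Stack : Set
data Term (n : ℕ) : Set

data Term n where
  var : Fin n → Term n
  app : Term n → Term n → Term n
  lam : Term (suc n) → Term n
  cc  : Term n
  kk  : Stack → Term n
  κ   : ℕ → Term n
  β   : ℕ → Term n

Λ : Set
Λ = Term 0

infixr 5 _·_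
data Stack where
  ω   : ℕ → Stack
  _·_ : Λ → Stack → Stack

ext : ∀ {m n} → (Fin m → Fin n) → Fin (suc m) → Fin (suc n)
ext ρ zero    = zero
ext ρ (suc i) = suc (ρ i)

rename : ∀ {m n} → (Fin m → Fin n) → Term m → Term n
rename ρ (var i)   = var (ρ i)
rename ρ (app t u) = app (rename ρ t) (rename ρ u)
rename ρ (lam t)   = lam (rename (ext ρ) t)
rename ρ cc        = cc
rename ρ (kk π)    = kk π
rename ρ (κ m)     = κ m
rename ρ (β m)     = β m

exts : ∀ {m n} → (Fin m → Term n) → Fin (suc m) → Term (suc n)
exts σ zero    = var zero
exts σ (suc i) = rename suc (σ i)

subst : ∀ {m n} → (Fin m → Term n) → Term m → Term n
subst σ (var i)   = σ i
subst σ (app t u) = app (subst σ t) (subst σ u)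
subst σ (lam t)   = lam (subst (exts σ) t)
subst σ cc        = cc
subst σ (kk π)    = kk π
subst σ (κ m)     = κ m
subst σ (β m)     = β m

_[0:=_] : Term 1 → Λ → Λ
t [0:= u ] = subst (λ { zero → u }) t

infix 4 _⋆_
record Process : Set where
  constructor _⋆_
  field
    term  : Λ
    stack : Stack

infix 3 _≻₁_ _≻_
data _≻₁_ : Process → Process → Set where
  push : ∀ {t u π}  → app t u ⋆ π ≻₁ t ⋆ u · π
  grab : ∀ {t u π}  → lam t ⋆ u · π ≻₁ (t [0:= u ]) ⋆ π
  save : ∀ {t π}    → cc ⋆ t · π ≻₁ t ⋆ kk π · π
  restore : ∀ {π' t π} → kk π' ⋆ t · π ≻₁ t ⋆ π'

_≻_ : Process → Process → Set
_≻_ = Star _≻₁_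

record Pole : Set₁ where
  field
    _∈⊥⊥ : Process → Set
    closed : ∀ {p q} → p ≻ q → q ∈⊥⊥ → p ∈⊥⊥
open Pole public

ProcSet : Set₁
ProcSet = Process → Set

RealizabilityStructure : Set₂
RealizabilityStructure = Pole → Set₁

-- Second-order formulas (the fragment needed: unary second-order
-- variables applied to numerals, implication, second-order ∀).
-- Formula n has n free second-order variables (de Bruijn).

infixr 4 _⇒_
data Formula (n : ℕ) : Set where
  atom : Fin n → ℕ → Formula n
  _⇒_  : Formula n → Formula n → Formula n
  ∀X   : Formula (suc n) → Formula n

-- a falsity-value assignment F : ℕ → P(Π)
Pred2 : Set₁
Pred2 = ℕ → Stack → Set

cons : ∀ {n} → Pred2 → (Fin n → Pred2) → Fin (suc n) → Pred2
cons F ρ zero    = F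
cons F ρ (suc i) = ρ i

mutual
  ‖_‖ : ∀ {n} → Formula n → Pole → (Fin n → Pred2) → Stack → Set₁
  ‖ atom X k ‖ P ρ π = Lift (Level.suc Level.zero) (ρ X k π)
  ‖ A ⇒ B ‖ P ρ π = Σ Λ λ t → Σ Stack λ π' →
                       (π ≡ t · π') × (∣ A ∣ P ρ t × ‖ B ‖ P ρ π')
  ‖ ∀X A ‖ P ρ π = Σ Pred2 λ F → ‖ A ‖ P (cons F ρ) π

  ∣_∣ : ∀ {n} → Formula n → Pole → (Fin n → Pred2) → Λ → Set₁
  ∣ A ∣ P ρ t = ∀ π → ‖ A ‖ P ρ π → Lift (Level.suc Level.zero) ((P ∈⊥⊥) (t ⋆ π))

empty : Fin 0 → Pred2
empty ()

_realizes_wrt_ : Λ → Formula 0 → RealizabilityStructure → Set₁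
t realizes A wrt S = ∀ P → S P → ∣ A ∣ P empty t

Bool : ℕ → Formula 0
Bool y = ∀X (atom zero 0 ⇒ atom zero 1 ⇒ atom zero y)

_≻[_]_ : ProcSet → RealizabilityStructure → ProcSet → Set₁
Pset ≻[ S ] Q = ∀ P → S P → (∀ q → Q q → (P ∈⊥⊥) q) →
                Σ Process λ p → Pset p × (P ∈⊥⊥) p

｛_｝ : Process → ProcSet
｛ p ｝ q = q ≡ p

module Submission where

-- Proof idea.  Write b ∈ {0,1} for a bit and choose b u v for u (b = 0)
-- resp. v (b = 1).  The theorem follows from two independent facts:
--
--  * pole-wise characterization: for every pole ⊥⊥, t ∈ |Bool(b)| iff
--    for all u, v, π, (choose b u v ⋆ π) ∈ ⊥⊥ implies (t ⋆ u·v·π) ∈ ⊥⊥.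
--    "⇐" unfolds a stack of ‖Bool(b)‖; "⇒" instantiates X by the
--    falsity value that is {π} at b and empty elsewhere, for which u and
--    v realize X(0) and X(1) as soon as choose b u v ⋆ π ∈ ⊥⊥.
--  * singleton reading of ≻_S: {p} ≻_S {q} iff every pole of S that
--    contains q also contains p.
--
-- Quantifying the first fact over the poles of S and rewriting with the
-- second gives, for each bit b, the equivalence of the theorem; the two
-- halves of the statement are the instances b = 0 and b = 1.

open import Defs
open import Data.Product using (_×_; _,_)
open import Data.Fin using (Fin; zero; suc; toℕ)
open import Data.Fin.Properties using (toℕ-injective)
open import Data.Nat using (ℕ)
open import Function.Bundles using (_⇔_; mk⇔; module Equivalence)
open import Level using (lift; lower)
open import Relation.Binary.PropositionalEquality
  using (_≡_; refl; sym) renaming (subst to transport)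

choose : Fin 2 → Λ → Λ → Λ
choose zero       u v = u
choose (suc zero) u v = v

-- The falsity value {π} at position k and empty elsewhere; it is the
-- instance of X that makes Bool(k) say exactly "select the k-th argument".
only : ℕ → Stack → Pred2
only k π k′ π′ = (k′ ≡ k) × (π′ ≡ π)

selected-in-pole : ∀ {n} (P : Pole) (ρ : Fin n → Pred2) (X : Fin n) (b : Fin 2)
  {u v : Λ} {π : Stack} →
  ∣ atom X 0 ∣ P ρ u → ∣ atom X 1 ∣ P ρ v → ‖ atom X (toℕ b) ‖ P ρ π →
  (P ∈⊥⊥) (choose b u v ⋆ π)
selected-in-pole P ρ X zero       u⊩ v⊩ π∈ = lower (u⊩ _ π∈)
selected-in-pole P ρ X (suc zero) u⊩ v⊩ π∈ = lower (v⊩ _ π∈)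

argument-realizes : (P : Pole) (b i : Fin 2) {u v : Λ} {π : Stack} →
  (P ∈⊥⊥) (choose b u v ⋆ π) →
  ∣ atom zero (toℕ i) ∣ P (cons (only (toℕ b) π) empty) (choose i u v)
argument-realizes P b i {u} {v} selected∈ _ (lift (i≡b , refl)) =
  lift (transport (λ j → (P ∈⊥⊥) (choose j u v ⋆ _))
                  (sym (toℕ-injective i≡b)) selected∈)

Bool-pole : (P : Pole) (b : Fin 2) (t : Λ) →
  ∣ Bool (toℕ b) ∣ P empty t ⇔
  (∀ (u v : Λ) (π : Stack) → (P ∈⊥⊥) (choose b u v ⋆ π) → (P ∈⊥⊥) (t ⋆ u · v · π))
Bool-pole P b t = mk⇔ to from
  where
  to : ∣ Bool (toℕ b) ∣ P empty t →
       ∀ u v π → (P ∈⊥⊥) (choose b u v ⋆ π) → (P ∈⊥⊥) (t ⋆ u · v · π)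
  to t⊩ u v π selected∈ = lower (t⊩ (u · v · π)
    ( only (toℕ b) π
    , u , v · π , refl , argument-realizes P b zero selected∈
    , v , π , refl , argument-realizes P b (suc zero) selected∈
    , lift (refl , refl)))

  from : (∀ u v π → (P ∈⊥⊥) (choose b u v ⋆ π) → (P ∈⊥⊥) (t ⋆ u · v · π)) →
         ∣ Bool (toℕ b) ∣ P empty t
  from h _ (F , u , _ , refl , u⊩ , v , π , refl , v⊩ , π∈) =
    lift (h u v π (selected-in-pole P (cons F empty) zero b u⊩ v⊩ π∈))

singleton-≻ : (S : RealizabilityStructure) (p q : Process) →
  ｛ p ｝ ≻[ S ] ｛ q ｝ ⇔ (∀ P → S P → (P ∈⊥⊥) q → (P ∈⊥⊥) p)
singleton-≻ S p q = mk⇔ to from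
  where
  to : ｛ p ｝ ≻[ S ] ｛ q ｝ → ∀ P → S P → (P ∈⊥⊥) q → (P ∈⊥⊥) p
  to h P SP q∈ with h P SP (λ { _ refl → q∈ })
  ... | _ , refl , p∈ = p∈

  from : (∀ P → S P → (P ∈⊥⊥) q → (P ∈⊥⊥) p) → ｛ p ｝ ≻[ S ] ｛ q ｝
  from h P SP Q⊆P = p , refl , h P SP (Q⊆P q refl)

Bool-realizes : (S : RealizabilityStructure) (b : Fin 2) (t : Λ) →
  (t realizes Bool (toℕ b) wrt S) ⇔
  (∀ (u v : Λ) (π : Stack) → ｛ t ⋆ u · v · π ｝ ≻[ S ] ｛ choose b u v ⋆ π ｝)
Bool-realizes S b t = mk⇔
  (λ r u v π → from (singleton-≻ S _ _)
    (λ P SP → to (Bool-pole P b t) (r P SP) u v π))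
  (λ h P SP → from (Bool-pole P b t)
    (λ u v π → to (singleton-≻ S _ _) (h u v π) P SP))
  where open Equivalence

mainTheorem14 : (S : RealizabilityStructure) (t : Λ) →
    ((t realizes Bool 0 wrt S) ⇔
       (∀ (u v : Λ) (π : Stack) → ｛ t ⋆ u · v · π ｝ ≻[ S ] ｛ u ⋆ π ｝))
    ×
    ((t realizes Bool 1 wrt S) ⇔
       (∀ (u v : Λ) (π : Stack) → ｛ t ⋆ u · v · π ｝ ≻[ S ] ｛ v ⋆ π ｝))
mainTheorem14 S t = Bool-realizes S zero t , Bool-realizes S (suc zero) t
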